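{- Let $T$ be a tree presentation, in any signature with equality, such that $[T]$ has at least one non-isolated path. Let $\alpha(F,G)$ be the formula $\exists H[(F=G\wedge F\neq H)\vee(F\neq G\wedge F=H)]$. Then there is no computable Skolem function for $\alpha$ in $T$.
   Context: A (computable) tree presentation: a computable subtree $T\subseteq\omega^{<\omega}$ with all nodes extendible, and Turing functionals computing each function symbol as a total map from tuples of paths in $[T]$ to paths in $[T]$; $\mathcal{A}_T$ has domain $[T]$. A path $P$ is isolated if some finite initial segment $\sigma\sqsubset P$ has $P$ as the only path through $\sigma$. Generalized Skolem function: for a structure $\mathcal{A}$ and formula $\alpha(\vec x)$ of the form $\exists y\,\beta(\vec x,y)$, a partial function $F:\mathcal{A}^n\to\mathcal{A}$ whose domain includes every $\vec a$ with $\mathcal{A}\models\alpha(\vec a)$, and such that $\mathcal{A}\models\beta(\vec a,F(\vec a))$ whenever $\mathcal{A}\models\alpha(\vec a)$. Such $F$ is computable in the presentation $T$ if there is a Turing functional $\Psi$ such that for all $\vec P$ in the domain of $F$, $\Psi^{\vec P}$ (with oracle the join of the paths) is total and equals the path $F(\vec P)\in[T]$. -}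

module Defs where

open import Data.Nat using (ℕ; zero; suc)
open import Data.Nat.DivMod using (_/_; _mod_)
open import Data.Fin using (Fin; zero; suc)
open import Data.List using (List; _++_; _∷ʳ_; map; upTo)
open import Data.Maybe using (Maybe; just)
open import Data.Product using (Σ; ∃; _×_)
open import Data.Sum using (_⊎_)
open import Relation.Binary.PropositionalEquality using (_≡_)
open import Relation.Nullary using (¬_; Dec)

Seq : Set
Seq = ℕ → ℕ

_↾_ : Seq → ℕ → List ℕ
X ↾ k = map X (upTo k)

_≈_ : Seq → Seq → Set
X ≈ Y = ∀ n → X n ≡ Y n

-- A Turing functional, given by its (decidable) finite-use approximations:
-- run σ n ≡ just m means "with oracle prefix σ, the computation on input n
-- has halted with output m, querying only σ".
record TuringFunctional : Set where
  field
    run  : List ℕ → ℕ → Maybe ℕ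
    mono : ∀ σ τ n m → run σ n ≡ just m → run (σ ++ τ) n ≡ just m
open TuringFunctional public

Outputs : TuringFunctional → Seq → ℕ → ℕ → Set
Outputs Φ X n m = ∃ λ k → run Φ (X ↾ k) n ≡ just m

Computes : TuringFunctional → Seq → Seq → Set
Computes Φ X Y = ∀ n → Outputs Φ X n (Y n)

join : (k : ℕ) → (Fin k → Seq) → Seq
join zero    Ps n = 0
join (suc k) Ps n = Ps (n mod suc k) (n / suc k)

pair : Seq → Seq → Fin 2 → Seq
pair P Q zero       = P
pair P Q (suc zero) = Q

record Tree : Set₁ where
  field
    Node          : List ℕ → Set
    node?         : ∀ σ → Dec (Node σ)
    prefix-closed : ∀ σ τ → Node (σ ++ τ) → Node σ
    extendible    : ∀ σ → Node σ → ∃ λ m → Node (σ ∷ʳ m)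
open Tree public

IsPath : Tree → Seq → Set
IsPath T P = ∀ k → Node T (P ↾ k)

Isolated : Tree → Seq → Set
Isolated T P = ∃ λ k → ∀ Q → IsPath T Q → P ↾ k ≡ Q ↾ k → Q ≈ P

record Signature : Set₁ where
  field
    Fun   : Set
    arity : Fun → ℕ
open Signature public

record TreePresentation (S : Signature) : Set₁ where
  field
    tree       : Tree
    functional : Fun S → TuringFunctional
    functional-total :
      ∀ f (Ps : Fin (arity S f) → Seq) → (∀ i → IsPath tree (Ps i)) →
      ∃ λ R → IsPath tree R × Computes (functional f) (join (arity S f) Ps) R
open TreePresentation public

β : Seq → Seq → Seq → Set
β F G H = (F ≈ G × ¬ (F ≈ H)) ⊎ (¬ (F ≈ G) × F ≈ H)

SatAlpha : Tree → Seq → Seq → Set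
SatAlpha T F G = ∃ λ H → IsPath T H × β F G H

ComputableSkolemAlpha : Tree → Set
ComputableSkolemAlpha T =
  Σ TuringFunctional λ Ψ →
    ∀ P Q → IsPath T P → IsPath T Q → SatAlpha T P Q →
    ∃ λ H → IsPath T H × Computes Ψ (join 2 (pair P Q)) H × β P Q H

{-# OPTIONS --safe #-}
-- Suppose Ψ were such a Skolem function and P a non-isolated path. Some path
-- differs from P, so α(P,P) holds and Ψ^{P⊕P} is a path H ≠ P, say H(n) ≠ P(n).
-- The computation of Ψ^{P⊕P}(n) reads only some prefix of P⊕P, hence only P↾k
-- for some k. A path Q ≠ P through P↾k makes α(P,Q) true with witness P, and β
-- then forces Ψ^{P⊕Q} = P; yet Ψ^{P⊕Q}(n) = H(n) because P⊕Q and P⊕P agree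
-- below k. Each "choose" above only holds under a double negation, which is
-- harmless since equality of paths is stable.
module Submission where

open import Defs
open import Data.Empty using (⊥-elim)
open import Data.Fin using (Fin; zero; suc)
open import Data.List using (_∷_; _++_; take; drop; map; upTo; applyUpTo)
open import Data.List.Properties
  using (∷-injectiveˡ; ∷-injectiveʳ; map-upTo; map-cong-local; take-map; take++drop≡id)
open import Data.List.Relation.Unary.All.Properties using (applyUpTo⁺₁)
open import Data.Maybe using (just)
open import Data.Maybe.Properties using (just-injective)
open import Data.Nat using (ℕ; zero; suc; _<_; _≤_; z≤n; s≤s; z<s; s<s)
open import Data.Nat.DivMod using (_mod_; m/n≤m)
open import Data.Nat.Properties using (_≟_; ≤-<-trans; m≤m⊔n; m≤n⊔m)
open import Data.Product using (∃; _×_; _,_; proj₁; proj₂)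
open import Data.Sum using (inj₁; inj₂)
open import Relation.Nullary using (¬_)
open import Relation.Nullary.Decidable using (decidable-stable)
open import Relation.Nullary.Negation using (Stable)
open import Relation.Binary.PropositionalEquality
  using (_≡_; refl; sym; trans; cong; subst; module ≡-Reasoning)

private
  variable
    X Y : Seq
    k m n a : ℕ

≈-refl : X ≈ X
≈-refl _ = refl

≈-sym : X ≈ Y → Y ≈ X
≈-sym X≈Y n = sym (X≈Y n)

≈-stable : Stable (X ≈ Y)
≈-stable {X} {Y} ¬¬X≈Y n = decidable-stable (X n ≟ Y n) λ Xn≢Yn → ¬¬X≈Y λ X≈Y → Xn≢Yn (X≈Y n)

agree⇒↾-≡ : (∀ {i} → i < k → X i ≡ Y i) → X ↾ k ≡ Y ↾ k
agree⇒↾-≡ {k} agree = map-cong-local (applyUpTo⁺₁ (λ i → i) k agree)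

applyUpTo-≡⇒agree : ∀ (X Y : Seq) k → applyUpTo X k ≡ applyUpTo Y k → ∀ {i} → i < k → X i ≡ Y i
applyUpTo-≡⇒agree X Y (suc k) eq z<s               = ∷-injectiveˡ eq
applyUpTo-≡⇒agree X Y (suc k) eq {suc i} (s<s i<k) =
  applyUpTo-≡⇒agree (λ i → X (suc i)) (λ i → Y (suc i)) k (∷-injectiveʳ eq) i<k

↾-≡⇒agree : X ↾ k ≡ Y ↾ k → ∀ {i} → i < k → X i ≡ Y i
↾-≡⇒agree {X} {k} {Y} eq = applyUpTo-≡⇒agree X Y k (trans (sym (map-upTo X k)) (trans eq (map-upTo Y k)))

take-applyUpTo : ∀ {A : Set} (f : ℕ → A) → k ≤ m → take k (applyUpTo f m) ≡ applyUpTo f k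
take-applyUpTo f z≤n       = refl
take-applyUpTo f (s≤s k≤m) = cong (f 0 ∷_) (take-applyUpTo (λ i → f (suc i)) k≤m)

↾-++-drop : k ≤ m → X ↾ k ++ drop k (X ↾ m) ≡ X ↾ m
↾-++-drop {k} {m} {X} k≤m = begin
  X ↾ k ++ drop k (X ↾ m)               ≡⟨ cong (_++ drop k (X ↾ m)) (sym take-↾) ⟩
  take k (X ↾ m) ++ drop k (X ↾ m)      ≡⟨ take++drop≡id k (X ↾ m) ⟩
  X ↾ m                                 ∎
  where
  open ≡-Reasoning
  take-↾ : take k (X ↾ m) ≡ X ↾ k
  take-↾ = trans (take-map k (upTo m)) (cong (map X) (take-applyUpTo (λ i → i) k≤m))

run-↾-mono : ∀ (Φ : TuringFunctional) → k ≤ m →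
             run Φ (X ↾ k) n ≡ just a → run Φ (X ↾ m) n ≡ just a
run-↾-mono {k} {m} {X} {n} {a} Φ k≤m halts =
  subst (λ σ → run Φ σ n ≡ just a) (↾-++-drop k≤m) (mono Φ (X ↾ k) (drop k (X ↾ m)) n a halts)

Outputs-unique : ∀ (Φ : TuringFunctional) {b} → Outputs Φ X n a → Outputs Φ X n b → a ≡ b
Outputs-unique Φ (k , halts) (k′ , halts′) =
  just-injective (trans (sym (run-↾-mono Φ (m≤m⊔n k k′) halts)) (run-↾-mono Φ (m≤n⊔m k k′) halts′))

Outputs-↾-cong : ∀ (Φ : TuringFunctional) →
                 run Φ (X ↾ k) n ≡ just a → X ↾ k ≡ Y ↾ k → Outputs Φ Y n a
Outputs-↾-cong {X} {k} {n} {a} Φ halts X↾k≡Y↾k =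
  k , subst (λ σ → run Φ σ n ≡ just a) X↾k≡Y↾k halts

join-↾-cong : ∀ j {Ps Qs : Fin j → Seq} → (∀ i → Ps i ↾ k ≡ Qs i ↾ k) → join j Ps ↾ k ≡ join j Qs ↾ k
join-↾-cong zero    _  = refl
join-↾-cong (suc j) Ps↾k≡Qs↾k = agree⇒↾-≡ λ {l} l<k →
  ↾-≡⇒agree (Ps↾k≡Qs↾k (l mod suc j)) (≤-<-trans (m/n≤m l (suc j)) l<k)

_⊕_ : Seq → Seq → Seq
P ⊕ Q = join 2 (pair P Q)

⊕-↾-congʳ : ∀ P {Q Q′ : Seq} → Q ↾ k ≡ Q′ ↾ k → (P ⊕ Q) ↾ k ≡ (P ⊕ Q′) ↾ k
⊕-↾-congʳ P {Q} {Q′} Q↾k≡Q′↾k = join-↾-cong 2 {pair P Q} {pair P Q′} λ where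
  zero       → refl
  (suc zero) → Q↾k≡Q′↾k

module _ (T : Tree) where

  ¬Isolated⇒¬¬∃-other-path-through : ∀ {P} → ¬ Isolated T P → ∀ k →
    ¬ ¬ (∃ λ Q → IsPath T Q × P ↾ k ≡ Q ↾ k × ¬ P ≈ Q)
  ¬Isolated⇒¬¬∃-other-path-through ¬isolated k ∄other = ¬isolated (k , λ Q pathQ P↾k≡Q↾k →
    ≈-stable λ Q≉P → ∄other (Q , pathQ , P↾k≡Q↾k , λ P≈Q → Q≉P (≈-sym P≈Q)))

  module _ (skolem : ComputableSkolemAlpha T) where

    private
      Ψ : TuringFunctional
      Ψ = proj₁ skolem

    skolem-diagonal-≉ : ∀ {P Q} → IsPath T P → IsPath T Q → ¬ P ≈ Q →
                        ∃ λ H → Computes Ψ (P ⊕ P) H × ¬ P ≈ H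
    skolem-diagonal-≉ pathP pathQ P≉Q with proj₂ skolem _ _ pathP pathP (_ , pathQ , inj₁ (≈-refl , P≉Q))
    ... | H , _ , computesH , inj₁ (_ , P≉H) = H , computesH , P≉H
    ... | _ , _ , _         , inj₂ (P≉P , _) = ⊥-elim (P≉P ≈-refl)

    skolem-offDiagonal-≈ : ∀ {P Q} → IsPath T P → IsPath T Q → ¬ P ≈ Q →
                           ∃ λ H → Computes Ψ (P ⊕ Q) H × P ≈ H
    skolem-offDiagonal-≈ pathP pathQ P≉Q with proj₂ skolem _ _ pathP pathQ (_ , pathP , inj₂ (P≉Q , ≈-refl))
    ... | _ , _ , _         , inj₁ (P≈Q , _) = ⊥-elim (P≉Q P≈Q)
    ... | H , _ , computesH , inj₂ (_ , P≈H) = H , computesH , P≈H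

    ¬Isolated⇒skolem-diagonal-≈ : ∀ {P H} → IsPath T P → ¬ Isolated T P → Computes Ψ (P ⊕ P) H → P ≈ H
    ¬Isolated⇒skolem-diagonal-≈ {P} {H} pathP ¬isolated computesH n =
      decidable-stable (P n ≟ H n) λ Pn≢Hn →
        let k , halts = computesH n in
        ¬Isolated⇒¬¬∃-other-path-through ¬isolated k λ (Q , pathQ , P↾k≡Q↾k , P≉Q) →
          let _ , computesH′ , P≈H′ = skolem-offDiagonal-≈ pathP pathQ P≉Q
              H′n≡Hn = Outputs-unique Ψ (computesH′ n) (Outputs-↾-cong Ψ halts (⊕-↾-congʳ P P↾k≡Q↾k))
          in Pn≢Hn (trans (P≈H′ n) H′n≡Hn)

proposition3p8 : (S : Signature) (𝒯 : TreePresentation S) →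
    (∃ λ P → IsPath (tree 𝒯) P × ¬ Isolated (tree 𝒯) P) →
    ¬ ComputableSkolemAlpha (tree 𝒯)
proposition3p8 _ 𝒯 (P , pathP , ¬isolated) skolem =
  ¬Isolated⇒¬¬∃-other-path-through T ¬isolated 0 λ (Q , pathQ , _ , P≉Q) →
    let _ , computesH , P≉H = skolem-diagonal-≉ T skolem pathP pathQ P≉Q
    in P≉H (¬Isolated⇒skolem-diagonal-≈ T skolem pathP ¬isolated computesH)
  where
  T : Tree
  T = tree 𝒯
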